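{- Let $G$ be a chordal cograph without true twins and let $\mathcal{T}$ be the cotree of $G$. Then every internal node of $\mathcal{T}$ labelled with $\otimes$ has exactly two children, one of which is a leaf and the other of which is a node labelled with $\oplus$.
   Context: Graphs are finite and simple. A chordal cograph is a graph with no induced path on four vertices and no induced cycle on four vertices. Two adjacent vertices $x,y$ of $G$ are true twins if for every $z\in V(G)\setminus\{x,y\}$, $xz\in E(G)$ iff $yz\in E(G)$. For graphs $H_1,\dots,H_r$ on disjoint vertex sets, $\oplus(H_1,\dots,H_r)$ is their disjoint union and $\otimes(H_1,\dots,H_r)$ is their full join (disjoint union plus all edges between vertices of different $H_i$). The cotree of a cograph $G$ is the unique rooted tree whose leaves are the vertices of $G$ and whose internal nodes are labelled $\oplus$ or $\otimes$, such that each internal node has at least two children, no two adjacent internal nodes carry the same label, and each internal node represents the graph obtained by applying its label's operation to the graphs represented by its children (a leaf represents the one-vertex graph), the root representing $G$. -}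

module Defs where

open import Data.Nat using (ℕ; _≤_)
open import Data.Fin using (Fin)
open import Data.List using (List; []; _∷_; length; lookup)
open import Data.List.Relation.Unary.All using (All)
open import Data.List.Relation.Unary.Any using (Any)
open import Data.List.Relation.Unary.Unique.Propositional using (Unique)
open import Data.List.Membership.Propositional using (_∈_)
open import Data.Product using (Σ; ∃; ∃-syntax; _×_; _,_)
open import Data.Sum using (_⊎_)
open import Data.Empty using (⊥)
open import Relation.Nullary using (¬_)
open import Relation.Binary.Definitions using (Decidable)
open import Relation.Binary.PropositionalEquality using (_≡_; _≢_)
open import Function.Bundles using (_⇔_)

record Graph (n : ℕ) : Set₁ where
  field
    Adj    : Fin n → Fin n → Set
    sym    : ∀ {x y} → Adj x y → Adj y x
    irrefl : ∀ {x} → ¬ Adj x x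
    dec    : Decidable Adj
open Graph public

module _ {n : ℕ} (G : Graph n) where

  InducedP4 : Set
  InducedP4 = ∃[ a ] ∃[ b ] ∃[ c ] ∃[ d ]
    ( (a ≢ b × a ≢ c × a ≢ d × b ≢ c × b ≢ d × c ≢ d)
    × Adj G a b × Adj G b c × Adj G c d
    × ¬ Adj G a c × ¬ Adj G a d × ¬ Adj G b d )

  InducedC4 : Set
  InducedC4 = ∃[ a ] ∃[ b ] ∃[ c ] ∃[ d ]
    ( (a ≢ b × a ≢ c × a ≢ d × b ≢ c × b ≢ d × c ≢ d)
    × Adj G a b × Adj G b c × Adj G c d × Adj G d a
    × ¬ Adj G a c × ¬ Adj G b d )

  ChordalCograph : Set
  ChordalCograph = ¬ InducedP4 × ¬ InducedC4

  TrueTwins : Fin n → Fin n → Set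
  TrueTwins x y = Adj G x y ×
    (∀ z → z ≢ x → z ≢ y → (Adj G x z ⇔ Adj G y z))

  NoTrueTwins : Set
  NoTrueTwins = ∀ x y → ¬ TrueTwins x y

data Label : Set where
  ⊕ ⊗ : Label

data Cotree (V : Set) : Set where
  leaf : V → Cotree V
  node : Label → List (Cotree V) → Cotree V

module _ {V : Set} where

  mutual
    leaves : Cotree V → List V
    leaves (leaf v)    = v ∷ []
    leaves (node _ ts) = leavesL ts

    leavesL : List (Cotree V) → List V
    leavesL []       = []
    leavesL (t ∷ ts) = leaves t Data.List.++ leavesL ts

  LabelledBy : Label → Cotree V → Set
  LabelledBy l (leaf _)     = ⊥
  LabelledBy l (node l' _) = l ≡ l'

  data Canonical : Cotree V → Set where
    leafC : ∀ {v} → Canonical (leaf v)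
    nodeC : ∀ {l ts} → 2 ≤ length ts → All Canonical ts →
            All (λ c → ¬ LabelledBy l c) ts → Canonical (node l ts)

  -- adjacency in the graph represented by a cotree:
  -- ⊕ = disjoint union, ⊗ = full join
  data TAdj (x y : V) : Cotree V → Set where
    inside : ∀ {l ts} → Any (TAdj x y) ts → TAdj x y (node l ts)
    across : ∀ {ts} (i j : Fin (length ts)) → i ≢ j →
             x ∈ leaves (lookup ts i) → y ∈ leaves (lookup ts j) →
             TAdj x y (node ⊗ ts)

  data _⊑_ (S : Cotree V) : Cotree V → Set where
    here  : S ⊑ S
    child : ∀ {l ts} → Any (S ⊑_) ts → S ⊑ node l ts

IsCotreeOf : {n : ℕ} → Graph n → Cotree (Fin n) → Set
IsCotreeOf G T =
  Canonical T × Unique (leaves T) × (∀ v → v ∈ leaves T) ×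
  (∀ x y → Adj G x y ⇔ TAdj x y T)

LeafAndPlus : {V : Set} → List (Cotree V) → Set
LeafAndPlus {V} cs = ∃[ v ] ∃[ ts ]
  (cs ≡ leaf v ∷ node ⊕ ts ∷ [] ⊎ cs ≡ node ⊕ ts ∷ leaf v ∷ [])

{-# OPTIONS --safe #-}
-- Let cs be the children of a ⊗-node.  Vertices lying in different children
-- are adjacent, and a vertex outside the ⊗-node sees either all of its
-- vertices or none.  Hence two leaf children would be true twins, and two
-- ⊕-children, each containing two non-adjacent vertices, would span an
-- induced C4.  By canonicity no child is a ⊗-node, so the (at least two)
-- children are one leaf and one ⊕-node.
module Submission where

open import Data.Nat using (ℕ; _≤_; s≤s)
open import Data.Fin using (Fin; zero; suc) renaming (_≟_ to _≟ᶠ_)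
open import Data.List using (List; []; _∷_; length; lookup; _++_)
open import Data.List.Properties using (tabulate-lookup)
open import Data.List.Relation.Unary.All as All using (All; []; _∷_)
open import Data.List.Relation.Unary.All.Properties using (++⁻ˡ; ++⁻ʳ)
open import Data.List.Relation.Unary.Any using (Any; here; there; index)
open import Data.List.Relation.Unary.Any.Properties using (lookup-index)
open import Data.List.Relation.Unary.AllPairs using (AllPairs; []; _∷_)
import Data.List.Relation.Unary.AllPairs.Properties as AllPairs
open import Data.List.Relation.Unary.Unique.Propositional using (Unique)
open import Data.List.Relation.Binary.Disjoint.Propositional using (Disjoint)
open import Data.List.Membership.Propositional using (_∈_; _∉_; lose)
open import Data.List.Membership.Propositional.Properties
  using (∈-++⁺ˡ; ∈-++⁺ʳ; ∈-++⁻; ∈-lookup)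
import Data.List.Membership.DecPropositional as DecMembership
open import Data.Product using (∃₂; ∃-syntax; _×_; _,_; proj₁; proj₂)
open import Data.Sum using (_⊎_; inj₁; inj₂; [_,_])
open import Data.Empty using (⊥-elim)
open import Function.Base using (_∘_)
open import Function.Bundles using (_⇔_; mk⇔; Equivalence)
open import Relation.Nullary using (¬_; yes; no)
open import Relation.Binary.PropositionalEquality
  using (_≡_; _≢_; refl; sym; trans; cong; subst)
open import Defs hiding (sym)

module _ {a} {A : Set a} where

  Unique-++⁻ : ∀ (xs : List A) {ys} → Unique (xs ++ ys) →
               Unique xs × Unique ys × Disjoint xs ys
  Unique-++⁻ []       u        = [] , u , λ ()
  Unique-++⁻ (x ∷ xs) (x∉ ∷ u) with Unique-++⁻ xs u
  ... | uxs , uys , xs#ys = ++⁻ˡ xs x∉ ∷ uxs , uys , disjoint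
    where
    disjoint : Disjoint (x ∷ xs) _
    disjoint (here refl  , v∈ys) = All.lookup (++⁻ʳ xs x∉) v∈ys refl
    disjoint (there v∈xs , v∈ys) = xs#ys (v∈xs , v∈ys)

  AllPairs-lookup⁺ : ∀ {r} {R : A → A → Set r} {xs : List A} →
    (∀ {i j} → i ≢ j → R (lookup xs i) (lookup xs j)) → AllPairs R xs
  AllPairs-lookup⁺ {R = R} {xs} h =
    subst (AllPairs R) (tabulate-lookup xs) (AllPairs.tabulate⁺ h)

module _ {V : Set} where

  ∈-leavesL⁺ : ∀ {x : V} ts (k : Fin (length ts)) →
               x ∈ leaves (lookup ts k) → x ∈ leavesL ts
  ∈-leavesL⁺ (t ∷ ts) zero    x∈ = ∈-++⁺ˡ x∈
  ∈-leavesL⁺ (t ∷ ts) (suc k) x∈ = ∈-++⁺ʳ (leaves t) (∈-leavesL⁺ ts k x∈)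

  ∈-leavesL⁻ : ∀ {x : V} ts → x ∈ leavesL ts → ∃[ k ] x ∈ leaves (lookup ts k)
  ∈-leavesL⁻ (t ∷ ts) x∈ with ∈-++⁻ (leaves t) x∈
  ... | inj₁ x∈t  = zero , x∈t
  ... | inj₂ x∈ts with ∈-leavesL⁻ ts x∈ts
  ...   | k , x∈k = suc k , x∈k

  Unique-child : ∀ (ts : List (Cotree V)) (k : Fin (length ts)) →
                 Unique (leavesL ts) → Unique (leaves (lookup ts k))
  Unique-child (t ∷ ts) zero    u = proj₁ (Unique-++⁻ (leaves t) u)
  Unique-child (t ∷ ts) (suc k) u =
    Unique-child ts k (proj₁ (proj₂ (Unique-++⁻ (leaves t) u)))

  child-index-unique : ∀ {x : V} ts → Unique (leavesL ts) → (i j : Fin (length ts)) →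
    x ∈ leaves (lookup ts i) → x ∈ leaves (lookup ts j) → i ≡ j
  child-index-unique (t ∷ ts) u zero zero _ _ = refl
  child-index-unique (t ∷ ts) u zero (suc j) x∈t x∈ =
    ⊥-elim (proj₂ (proj₂ (Unique-++⁻ (leaves t) u)) (x∈t , ∈-leavesL⁺ ts j x∈))
  child-index-unique (t ∷ ts) u (suc i) zero x∈ x∈t =
    ⊥-elim (proj₂ (proj₂ (Unique-++⁻ (leaves t) u)) (x∈t , ∈-leavesL⁺ ts i x∈))
  child-index-unique (t ∷ ts) u (suc i) (suc j) x∈i x∈j =
    cong suc (child-index-unique ts (proj₁ (proj₂ (Unique-++⁻ (leaves t) u))) i j x∈i x∈j)

  distinct-children-disjoint : ∀ {x y : V} ts → Unique (leavesL ts) →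
    {i j : Fin (length ts)} → i ≢ j →
    x ∈ leaves (lookup ts i) → y ∈ leaves (lookup ts j) → x ≢ y
  distinct-children-disjoint ts u i≢j x∈ y∈ refl =
    i≢j (child-index-unique ts u _ _ x∈ y∈)

  Canonical⇒∃leaf : ∀ {t : Cotree V} → Canonical t → ∃[ v ] v ∈ leaves t
  Canonical⇒∃leaf (leafC {v}) = v , here refl
  Canonical⇒∃leaf (nodeC {ts = t ∷ _} _ (ct ∷ _) _) with Canonical⇒∃leaf ct
  ... | v , v∈t = v , ∈-++⁺ˡ v∈t

  ∈-leaf : ∀ {x : V} {t} → t ≡ leaf x → x ∈ leaves t
  ∈-leaf refl = here refl

  ∉-leaf : ∀ {x z : V} {t} → t ≡ leaf x → z ≢ x → z ∉ leaves t
  ∉-leaf refl z≢x (here z≡x) = z≢x z≡x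

  mutual
    TAdj⇒∈leaves : ∀ {x y : V} {t} → TAdj x y t → x ∈ leaves t × y ∈ leaves t
    TAdj⇒∈leaves (inside p) = TAdj⇒∈leavesL p
    TAdj⇒∈leaves {t = node _ ts} (across i j _ x∈ y∈) =
      ∈-leavesL⁺ ts i x∈ , ∈-leavesL⁺ ts j y∈

    TAdj⇒∈leavesL : ∀ {x y : V} {ts} → Any (TAdj x y) ts →
                    x ∈ leavesL ts × y ∈ leavesL ts
    TAdj⇒∈leavesL (here a) with TAdj⇒∈leaves a
    ... | x∈ , y∈ = ∈-++⁺ˡ x∈ , ∈-++⁺ˡ y∈
    TAdj⇒∈leavesL {ts = t ∷ _} (there p) with TAdj⇒∈leavesL p
    ... | x∈ , y∈ = ∈-++⁺ʳ (leaves t) x∈ , ∈-++⁺ʳ (leaves t) y∈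

  ⊕-children-nonadjacent : ∀ {x y : V} ts → Unique (leavesL ts) →
    {i j : Fin (length ts)} → i ≢ j →
    x ∈ leaves (lookup ts i) → y ∈ leaves (lookup ts j) → ¬ TAdj x y (node ⊕ ts)
  ⊕-children-nonadjacent ts u {i} {j} i≢j x∈ y∈ (inside p) =
    i≢j (trans (child-index-unique ts u i (index p) x∈ (proj₁ x∈p,y∈p))
               (sym (child-index-unique ts u j (index p) y∈ (proj₂ x∈p,y∈p))))
    where x∈p,y∈p = TAdj⇒∈leaves (lookup-index p)

  infix 4 _≼_

  -- Like _⊑_, but the path to the subtree is given by child positions, as in TAdj.
  data _≼_ (S : Cotree V) : Cotree V → Set where
    ≼-refl  : S ≼ S
    ≼-child : ∀ {l ts} (k : Fin (length ts)) → S ≼ lookup ts k → S ≼ node l ts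

  mutual
    ⊑⇒≼ : ∀ {S T} → S ⊑ T → S ≼ T
    ⊑⇒≼ here      = ≼-refl
    ⊑⇒≼ (child p) with ⊑⇒≼-child p
    ... | k , S≼k = ≼-child k S≼k

    ⊑⇒≼-child : ∀ {S ts} → Any (S ⊑_) ts → ∃[ k ] S ≼ lookup ts k
    ⊑⇒≼-child (here S⊑t) = zero , ⊑⇒≼ S⊑t
    ⊑⇒≼-child (there p) with ⊑⇒≼-child p
    ... | k , S≼k = suc k , S≼k

  ≼-trans : ∀ {R S T} → R ≼ S → S ≼ T → R ≼ T
  ≼-trans R≼S ≼-refl          = R≼S
  ≼-trans R≼S (≼-child k S≼k) = ≼-child k (≼-trans R≼S S≼k)

  ≼-descend : ∀ {P : Cotree V → Set} →
    (∀ {l ts} k → P (node l ts) → P (lookup ts k)) →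
    ∀ {S T} → S ≼ T → P T → P S
  ≼-descend step ≼-refl          pT = pT
  ≼-descend step (≼-child k S≼k) pT = ≼-descend step S≼k (step k pT)

  ≼-ascend : ∀ {P : Cotree V → Set} →
    (∀ {l ts} k → P (lookup ts k) → P (node l ts)) →
    ∀ {S T} → S ≼ T → P S → P T
  ≼-ascend step ≼-refl          pS = pS
  ≼-ascend step (≼-child k S≼k) pS = step k (≼-ascend step S≼k pS)

  Canonical-≼ : ∀ {S T} → S ≼ T → Canonical T → Canonical S
  Canonical-≼ = ≼-descend λ { k (nodeC _ cts _) → All.lookup cts (∈-lookup k) }

  Unique-≼ : ∀ {S T} → S ≼ T → Unique (leaves T) → Unique (leaves S)
  Unique-≼ = ≼-descend λ {_} {ts} → Unique-child ts

  ∈-≼ : ∀ {x S T} → S ≼ T → x ∈ leaves S → x ∈ leaves T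
  ∈-≼ = ≼-ascend λ {_} {ts} → ∈-leavesL⁺ ts

  TAdj-≼ : ∀ {x y S T} → S ≼ T → TAdj x y S → TAdj x y T
  TAdj-≼ = ≼-ascend λ k a → inside (lose (∈-lookup k) a)

  Any-TAdj-child : ∀ {x y : V} ts → Unique (leavesL ts) → (p : Any (TAdj x y) ts) →
    {k : Fin (length ts)} → x ∈ leaves (lookup ts k) → TAdj x y (lookup ts k)
  Any-TAdj-child ts u p x∈k =
    subst (λ i → TAdj _ _ (lookup ts i))
          (child-index-unique ts u _ _ (proj₁ (TAdj⇒∈leaves (lookup-index p))) x∈k)
          (lookup-index p)

  TAdj-restrict : ∀ {x y S T} → Unique (leaves T) → S ≼ T →
    x ∈ leaves S → y ∈ leaves S → TAdj x y T → TAdj x y S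
  TAdj-restrict u ≼-refl _ _ a = a
  TAdj-restrict {T = node _ ts} u (≼-child k S≼k) x∈ y∈ (inside p) =
    TAdj-restrict (Unique-child ts k u) S≼k x∈ y∈ (Any-TAdj-child ts u p (∈-≼ S≼k x∈))
  TAdj-restrict {T = node _ ts} u (≼-child k S≼k) x∈ y∈ (across i j i≢j x∈i y∈j) =
    ⊥-elim (i≢j (trans (child-index-unique ts u i k x∈i (∈-≼ S≼k x∈))
                       (child-index-unique ts u k j (∈-≼ S≼k y∈) y∈j)))

  -- An edge from x ∈ S to z ∉ S is created at a proper ancestor of S, where x
  -- and y lie in the same child.
  TAdj-outside : ∀ {x y z S T} → Unique (leaves T) → S ≼ T →
    x ∈ leaves S → y ∈ leaves S → z ∉ leaves S → TAdj x z T → TAdj y z T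
  TAdj-outside u ≼-refl _ _ z∉ a = ⊥-elim (z∉ (proj₂ (TAdj⇒∈leaves a)))
  TAdj-outside {T = node _ ts} u (≼-child k S≼k) x∈ y∈ z∉ (inside p) =
    inside (lose (∈-lookup k)
      (TAdj-outside (Unique-child ts k u) S≼k x∈ y∈ z∉ (Any-TAdj-child ts u p (∈-≼ S≼k x∈))))
  TAdj-outside {T = node _ ts} u (≼-child k S≼k) x∈ y∈ z∉ (across i j i≢j x∈i z∈j) =
    across k j (i≢j ∘ trans (child-index-unique ts u i k x∈i (∈-≼ S≼k x∈))) (∈-≼ S≼k y∈) z∈j

  ⊕-nonedge : ∀ {ts : List (Cotree V)} → Canonical (node ⊕ ts) → Unique (leavesL ts) →
    ∃₂ λ a b → a ∈ leavesL ts × b ∈ leavesL ts × a ≢ b × ¬ TAdj a b (node ⊕ ts)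
  ⊕-nonedge {t₀ ∷ t₁ ∷ ts} (nodeC _ (c₀ ∷ c₁ ∷ _) _) u
    with Canonical⇒∃leaf c₀ | Canonical⇒∃leaf c₁
  ... | a , a∈ | b , b∈ =
    a , b , ∈-leavesL⁺ (t₀ ∷ t₁ ∷ ts) zero a∈ , ∈-leavesL⁺ (t₀ ∷ t₁ ∷ ts) (suc zero) b∈ ,
    distinct-children-disjoint (t₀ ∷ t₁ ∷ ts) u 0≢1 a∈ b∈ ,
    ⊕-children-nonadjacent (t₀ ∷ t₁ ∷ ts) u 0≢1 a∈ b∈
    where
    0≢1 : zero ≢ suc zero
    0≢1 ()
  ⊕-nonedge {_ ∷ []} (nodeC (s≤s ()) _ _) _

  data Clash : Cotree V → Cotree V → Set where
    leaf-leaf : ∀ {x y} → Clash (leaf x) (leaf y)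
    ⊕-⊕       : ∀ {ts us} → Clash (node ⊕ ts) (node ⊕ us)

  data LeafOr⊕ : Cotree V → Set where
    leaf : ∀ {x} → LeafOr⊕ (leaf x)
    ⊕    : ∀ {ts} → LeafOr⊕ (node ⊕ ts)

  ¬⊗⇒LeafOr⊕ : ∀ {t} → ¬ LabelledBy ⊗ t → LeafOr⊕ t
  ¬⊗⇒LeafOr⊕ {leaf _}     _  = leaf
  ¬⊗⇒LeafOr⊕ {node ⊕ _}   _  = ⊕
  ¬⊗⇒LeafOr⊕ {node ⊗ _} ¬⊗ = ⊥-elim (¬⊗ refl)

  pigeonhole : ∀ {a b c} → LeafOr⊕ a → LeafOr⊕ b → LeafOr⊕ c →
               Clash a b ⊎ Clash a c ⊎ Clash b c
  pigeonhole leaf leaf _    = inj₁ leaf-leaf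
  pigeonhole ⊕    ⊕    _    = inj₁ ⊕-⊕
  pigeonhole leaf ⊕    leaf = inj₂ (inj₁ leaf-leaf)
  pigeonhole leaf ⊕    ⊕    = inj₂ (inj₂ ⊕-⊕)
  pigeonhole ⊕    leaf leaf = inj₂ (inj₂ leaf-leaf)
  pigeonhole ⊕    leaf ⊕    = inj₂ (inj₁ ⊕-⊕)

  nonclashing-pair : ∀ {a b} → LeafOr⊕ a → LeafOr⊕ b → ¬ Clash a b →
                     LeafAndPlus (a ∷ b ∷ [])
  nonclashing-pair leaf leaf ¬c = ⊥-elim (¬c leaf-leaf)
  nonclashing-pair leaf ⊕    _  = _ , _ , inj₁ refl
  nonclashing-pair ⊕    leaf _  = _ , _ , inj₂ refl
  nonclashing-pair ⊕    ⊕    ¬c = ⊥-elim (¬c ⊕-⊕)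

  nonclashing-children : ∀ {cs : List (Cotree V)} → 2 ≤ length cs →
    All (λ c → ¬ LabelledBy ⊗ c) cs → AllPairs (λ s t → ¬ Clash s t) cs →
    LeafAndPlus cs
  nonclashing-children {_ ∷ _ ∷ []} _ (¬⊗a ∷ ¬⊗b ∷ []) ((¬ab ∷ []) ∷ _) =
    nonclashing-pair (¬⊗⇒LeafOr⊕ ¬⊗a) (¬⊗⇒LeafOr⊕ ¬⊗b) ¬ab
  nonclashing-children {_ ∷ _ ∷ _ ∷ _} _ (¬⊗a ∷ ¬⊗b ∷ ¬⊗c ∷ _)
                       ((¬ab ∷ ¬ac ∷ _) ∷ (¬bc ∷ _) ∷ _) =
    ⊥-elim ([ ¬ab , [ ¬ac , ¬bc ] ]
      (pigeonhole (¬⊗⇒LeafOr⊕ ¬⊗a) (¬⊗⇒LeafOr⊕ ¬⊗b) (¬⊗⇒LeafOr⊕ ¬⊗c)))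
  nonclashing-children {_ ∷ []} (s≤s ()) _ _

Independent : {n : ℕ} → Graph n → List (Fin n) → Set
Independent G xs = ∃₂ λ a b → a ∈ xs × b ∈ xs × a ≢ b × ¬ Adj G a b

module Represents {n : ℕ} (G : Graph n) {T : Cotree (Fin n)}
  (canT : Canonical T) (uT : Unique (leaves T)) (adj : ∀ x y → Adj G x y ⇔ TAdj x y T)
  where

  open Equivalence
  open DecMembership (_≟ᶠ_ {n}) using (_∈?_)

  ⊕-independent : ∀ {ps} → node ⊕ ps ≼ T → Independent G (leavesL ps)
  ⊕-independent ⊕≼T with ⊕-nonedge (Canonical-≼ ⊕≼T canT) (Unique-≼ ⊕≼T uT)
  ... | a , b , a∈ , b∈ , a≢b , ¬ab =
    a , b , a∈ , b∈ , a≢b , ¬ab ∘ TAdj-restrict uT ⊕≼T a∈ b∈ ∘ to (adj a b)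

  module JoinNode {cs : List (Cotree (Fin n))} (⊗≼T : node ⊗ cs ≼ T) where

    Adj-across : ∀ {i j x y} → i ≢ j →
      x ∈ leaves (lookup cs i) → y ∈ leaves (lookup cs j) → Adj G x y
    Adj-across i≢j x∈ y∈ = from (adj _ _) (TAdj-≼ ⊗≼T (across _ _ i≢j x∈ y∈))

    Adj-outside-child : ∀ {x y z} j → x ∈ leavesL cs →
      y ∈ leaves (lookup cs j) → z ∉ leaves (lookup cs j) → Adj G x z → Adj G y z
    Adj-outside-child {z = z} j x∈ y∈ z∉j xz with z ∈? leavesL cs
    ... | yes z∈ with ∈-leavesL⁻ cs z∈
    ...   | k , z∈k = Adj-across (λ { refl → z∉j z∈k }) y∈ z∈k
    Adj-outside-child j x∈ y∈ z∉j xz | no z∉ =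
      from (adj _ _) (TAdj-outside uT ⊗≼T x∈ (∈-leavesL⁺ cs j y∈) z∉ (to (adj _ _) xz))

    leaf-children-twins : ∀ {i j x y} → i ≢ j →
      lookup cs i ≡ leaf x → lookup cs j ≡ leaf y → TrueTwins G x y
    leaf-children-twins {i} {j} i≢j eᵢ eⱼ =
      Adj-across i≢j (∈-leaf eᵢ) (∈-leaf eⱼ) ,
      λ z z≢x z≢y → mk⇔
        (Adj-outside-child j (∈-leavesL⁺ cs i (∈-leaf eᵢ)) (∈-leaf eⱼ) (∉-leaf eⱼ z≢y))
        (Adj-outside-child i (∈-leavesL⁺ cs j (∈-leaf eⱼ)) (∈-leaf eᵢ) (∉-leaf eᵢ z≢x))

    ⊕-child-independent : ∀ {i ps} → lookup cs i ≡ node ⊕ ps →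
      Independent G (leaves (lookup cs i))
    ⊕-child-independent {i} eᵢ =
      subst (Independent G ∘ leaves) (sym eᵢ)
        (⊕-independent (subst (_≼ T) eᵢ (≼-trans (≼-child i ≼-refl) ⊗≼T)))

    C4-across : ∀ {i j} → i ≢ j → Independent G (leaves (lookup cs i)) →
      Independent G (leaves (lookup cs j)) → InducedC4 G
    C4-across {i} {j} i≢j (a , a′ , a∈ , a′∈ , a≢a′ , ¬aa′) (b , b′ , b∈ , b′∈ , b≢b′ , ¬bb′) =
      a , b , a′ , b′ ,
      (apart a∈ b∈ , a≢a′ , apart a∈ b′∈ , apart a′∈ b∈ ∘ sym , b≢b′ , apart a′∈ b′∈) ,
      Adj-across i≢j a∈ b∈ , Adj-across j≢i b∈ a′∈ ,
      Adj-across i≢j a′∈ b′∈ , Adj-across j≢i b′∈ a∈ ,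
      ¬aa′ , ¬bb′
      where
      j≢i : j ≢ i
      j≢i = i≢j ∘ sym
      apart : ∀ {x y} → x ∈ leaves (lookup cs i) → y ∈ leaves (lookup cs j) → x ≢ y
      apart = distinct-children-disjoint cs (Unique-≼ ⊗≼T uT) i≢j

    clashing-children : ∀ {i j s t} → i ≢ j → lookup cs i ≡ s → lookup cs j ≡ t →
      Clash s t → (∃₂ λ x y → TrueTwins G x y) ⊎ InducedC4 G
    clashing-children i≢j eᵢ eⱼ leaf-leaf = inj₁ (_ , _ , leaf-children-twins i≢j eᵢ eⱼ)
    clashing-children i≢j eᵢ eⱼ ⊕-⊕ =
      inj₂ (C4-across i≢j (⊕-child-independent eᵢ) (⊕-child-independent eⱼ))

proposition1 : {n : ℕ} (G : Graph n) → ChordalCograph G → NoTrueTwins G →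
    (T : Cotree (Fin n)) → IsCotreeOf G T →
    (cs : List (Cotree (Fin n))) → node ⊗ cs ⊑ T → LeafAndPlus cs
proposition1 G (_ , no-C4) no-twins T (canT , uT , _ , adj) cs ⊗⊑T
  with Canonical-≼ (⊑⇒≼ ⊗⊑T) canT
... | nodeC 2≤|cs| _ no-⊗-child =
  nonclashing-children 2≤|cs| no-⊗-child (AllPairs-lookup⁺ no-clash)
  where
  open Represents G canT uT adj
  open JoinNode (⊑⇒≼ ⊗⊑T)

  no-clash : ∀ {i j} → i ≢ j → ¬ Clash (lookup cs i) (lookup cs j)
  no-clash i≢j clash =
    [ (λ { (x , y , twins) → no-twins x y twins }) , no-C4 ]
      (clashing-children i≢j refl refl clash)
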